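{- Suppose $\Gamma,X{:}\Box B\vdash r:A$ and $\Gamma\vdash\Box s:\Box B$, and suppose $\Gamma\vdash\varsigma$. Then $[\![r[X{:=}\Box s]]\!]_\varsigma=[\![r]\!]_{\varsigma[X:=[\![\Box s]\!]_\varsigma]}$.
   Context: Modal type system. Disjoint countably infinite sets $\mathbb A$ (atoms) and $\mathbb X$ (unknowns). Types: $A::=o\mid \mathbb N\mid A\to A\mid \Box A$. Constants $C$ with types, including $\top:o$, $\bot:o$, $\mathrm{isapp}_A:\Box A\to o$. Terms: $r::=C\mid a\mid X_@\mid \lambda a{:}A.r\mid rr\mid \Box r\mid \mathrm{letbox}\ X=s\ \mathrm{in}\ r$ (up to $\alpha$-equivalence). Free atoms: $\mathrm{fa}(C)=\mathrm{fa}(X_@)=\emptyset$, $\mathrm{fa}(a)=\{a\}$, $\mathrm{fa}(\lambda a{:}A.r)=\mathrm{fa}(r)\setminus\{a\}$, $\mathrm{fa}(rs)=\mathrm{fa}(r)\cup\mathrm{fa}(s)$, $\mathrm{fa}(\Box r)=\mathrm{fa}(r)$, $\mathrm{fa}(\mathrm{letbox}\ X=s\ \mathrm{in}\ r)=\mathrm{fa}(r)\cup\mathrm{fa}(s)$; free unknowns $\mathrm{fv}$ structural with $\mathrm{fv}(X_@)=\{X\}$ and letbox binding $X$. Typing contexts: finite partial functions from $\mathbb A\cup\mathbb X$ to types. Rules: (Hyp) $\Gamma,a{:}A\vdash a:A$; (Const) $\Gamma\vdash C:\mathrm{type}(C)$; (${\to}$I) from $\Gamma,a{:}A\vdash r:B$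 infer $\Gamma\vdash\lambda a{:}A.r:A\to B$; (${\to}$E) from $\Gamma\vdash r':A\to B$, $\Gamma\vdash r:A$ infer $\Gamma\vdash r'r:B$; ($\Box$I) from $\Gamma\vdash r:A$, $\mathrm{fa}(r)=\emptyset$ infer $\Gamma\vdash\Box r:\Box A$; ($\Box$E) from $\Gamma\vdash s:\Box A$, $\Gamma,X{:}\Box A\vdash r:B$ infer $\Gamma\vdash\mathrm{letbox}\ X=s\ \mathrm{in}\ r:B$; (Ext) $\Gamma,X{:}\Box A\vdash X_@:A$. An unknowns-substitution $\theta$ is a finite partial map from $\mathbb X$ to terms $\Box r'$ with $\mathrm{fa}(r')=\emptyset$; action: $C\theta=C$, $a\theta=a$, $(rs)\theta=(r\theta)(s\theta)$, $(\Box r)\theta=\Box(r\theta)$, $(\lambda c{:}A.r)\theta=\lambda c{:}A.(r\theta)$, $X_@\theta=s'$ if $\theta(X)=\Box s'$, $X_@\theta=X_@$ if $X\notin\mathrm{dom}\theta$, $(\mathrm{letbox}\ Y=s\ \mathrm{in}\ r)\theta=\mathrm{letbox}\ Y=s\theta\ \mathrm{in}\ r\theta$ (with $Y$ renamed away from $\theta$). $[X{:=}\Box s]$ is the singleton unknowns-substitution. Denotation: $[\![o]\!]=\{\top,\bot\}$, $[\![\mathbb N]\!]=\mathbb N$, $[\![A\to B]\!]$ = all functions, $[\![\Box A]\!]=\{\Box r\mid\emptyset\vdash\Box r:\Box A\}\times[\![A]\!]$ (pairs $\Box r::x$, projections $\mathrm{hd},\mathrm{tl}$). Valuations $\varsigma$: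 finite partial functions on $\mathbb A\cup\mathbb X$; $\Gamma\vdash\varsigma$ iff $\mathrm{dom}\Gamma=\mathrm{dom}\varsigma$ and $\varsigma(u)\in[\![\Gamma(u)]\!]$. $\varsigma_{\mathbb X}$: unknowns-substitution $X\mapsto\mathrm{hd}(\varsigma(X))$. Other constants have fixed $C^{[\![]\!]}\in[\![\mathrm{type}(C)]\!]$. $[\![\top]\!]_\varsigma=\top$, $[\![\bot]\!]_\varsigma=\bot$, $[\![C]\!]_\varsigma=C^{[\![]\!]}$, $[\![a]\!]_\varsigma=\varsigma(a)$, $[\![\lambda a{:}A.r]\!]_\varsigma=(x\mapsto[\![r]\!]_{\varsigma[a:=x]})$, $[\![r'r]\!]_\varsigma=[\![r']\!]_\varsigma([\![r]\!]_\varsigma)$, $[\![\Box r]\!]_\varsigma=\Box(r\varsigma_{\mathbb X})::[\![r]\!]_\varsigma$, $[\![X_@]\!]_\varsigma=\mathrm{tl}(\varsigma(X))$, $[\![\mathrm{letbox}\ X=s\ \mathrm{in}\ r]\!]_\varsigma=[\![r]\!]_{\varsigma[X:=[\![s]\!]_\varsigma]}$, $[\![\mathrm{isapp}_A]\!]_\varsigma(\Box r::x)=\top$ if $r$ is an application, else $\bot$. -}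

module Defs where

open import Data.Nat using (ℕ; zero; suc)
open import Data.Bool using (Bool; true; false)
open import Data.List using (List; []; _∷_)
open import Data.List.Relation.Unary.All using (All; []; _∷_)
open import Data.Product using (_×_; _,_; proj₁; proj₂)
open import Data.Empty using (⊥; ⊥-elim)
open import Data.Irrelevant using (Irrelevant; [_]; zipWith)
import Data.Irrelevant as Irr
open import Relation.Nullary using (¬_)

infixr 7 _⇒_
data Ty : Set where
  o   : Ty
  nat : Ty
  _⇒_ : Ty → Ty → Ty
  □   : Ty → Ty

infix 4 _∋_∶_
data _∋_∶_ : List Ty → ℕ → Ty → Set where
  here  : ∀ {Γ A} → (A ∷ Γ) ∋ zero ∶ A
  there : ∀ {Γ A B i} → Γ ∋ i ∶ A → (B ∷ Γ) ∋ suc i ∶ A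

module Lang (K : Set) (κ : K → Ty) where

  data Con : Set where
    top bot : Con
    isapp   : Ty → Con
    other   : K → Con

  ctype : Con → Ty
  ctype top       = o
  ctype bot       = o
  ctype (isapp A) = □ A ⇒ o
  ctype (other k) = κ k

  -- terms (de Bruijn: atoms and unknowns are indexed separately;
  -- lam binds atom 0, letbox binds unknown 0 in its body)
  data Tm : Set where
    con    : Con → Tm
    atom   : ℕ → Tm
    unk    : ℕ → Tm
    lam    : Ty → Tm → Tm
    app    : Tm → Tm → Tm
    box    : Tm → Tm
    letbox : Tm → Tm → Tm    -- letbox X = s in r

  isApp : Tm → Bool
  isApp (app _ _) = true
  isApp _         = false

  infix 4 _∈fa_
  data _∈fa_ : ℕ → Tm → Set where
    fa-atom : ∀ {i} → i ∈fa atom i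
    fa-lam  : ∀ {i A r} → suc i ∈fa r → i ∈fa lam A r
    fa-appˡ : ∀ {i r s} → i ∈fa r → i ∈fa app r s
    fa-appʳ : ∀ {i r s} → i ∈fa s → i ∈fa app r s
    fa-box  : ∀ {i r} → i ∈fa r → i ∈fa box r
    fa-letˡ : ∀ {i s r} → i ∈fa s → i ∈fa letbox s r
    fa-letʳ : ∀ {i s r} → i ∈fa r → i ∈fa letbox s r

  NoFreeAtoms : Tm → Set
  NoFreeAtoms r = ∀ i → ¬ (i ∈fa r)

  -- typing contexts: types of atoms, and for unknowns the type A with X : □ A
  infix 4 _∣_
  record Ctx : Set where
    constructor _∣_
    field
      atoms : List Ty
      unks  : List Ty

  infix 3 _⊢_∶_
  data _⊢_∶_ : Ctx → Tm → Ty → Set where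
    hyp    : ∀ {Γa Γx i A} → Γa ∋ i ∶ A → Γa ∣ Γx ⊢ atom i ∶ A
    const  : ∀ {Γ c} → Γ ⊢ con c ∶ ctype c
    lamI   : ∀ {Γa Γx A B r} → A ∷ Γa ∣ Γx ⊢ r ∶ B → Γa ∣ Γx ⊢ lam A r ∶ A ⇒ B
    appE   : ∀ {Γ A B r' r} → Γ ⊢ r' ∶ A ⇒ B → Γ ⊢ r ∶ A → Γ ⊢ app r' r ∶ B
    boxI   : ∀ {Γ A r} → Γ ⊢ r ∶ A → NoFreeAtoms r → Γ ⊢ box r ∶ □ A
    boxE   : ∀ {Γa Γx A B s r} → Γa ∣ Γx ⊢ s ∶ □ A → Γa ∣ A ∷ Γx ⊢ r ∶ B →
             Γa ∣ Γx ⊢ letbox s r ∶ B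
    ext    : ∀ {Γa Γx i A} → Γx ∋ i ∶ A → Γa ∣ Γx ⊢ unk i ∶ A

  liftR : (ℕ → ℕ) → ℕ → ℕ
  liftR ρ zero    = zero
  liftR ρ (suc i) = suc (ρ i)

  renU : (ℕ → ℕ) → Tm → Tm
  renU ρ (con c)      = con c
  renU ρ (atom i)     = atom i
  renU ρ (unk i)      = unk (ρ i)
  renU ρ (lam A r)    = lam A (renU ρ r)
  renU ρ (app r s)    = app (renU ρ r) (renU ρ s)
  renU ρ (box r)      = box (renU ρ r)
  renU ρ (letbox s r) = letbox (renU ρ s) (renU (liftR ρ) r)

  -- an unknowns-substitution: σ i is the term s' with θ(X_i) = □ s'
  -- (σ i = unk i' encodes "not in the domain", after de Bruijn reindexing)
  liftS : (ℕ → Tm) → ℕ → Tm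
  liftS σ zero    = unk zero
  liftS σ (suc i) = renU suc (σ i)

  sub : (ℕ → Tm) → Tm → Tm
  sub σ (con c)      = con c
  sub σ (atom i)     = atom i
  sub σ (unk i)      = σ i
  sub σ (lam A r)    = lam A (sub σ r)
  sub σ (app r s)    = app (sub σ r) (sub σ s)
  sub σ (box r)      = box (sub σ r)
  sub σ (letbox s r) = letbox (sub σ s) (sub (liftS σ) r)

  single : Tm → ℕ → Tm
  single s zero    = s
  single s (suc i) = unk i

  _[X:=□_] : Tm → Tm → Tm
  r [X:=□ s ] = sub (single s) r

  -- auxiliary facts needed to *define* the denotation of □ r
  -- (its syntactic component must be a closed well-typed boxed term)

  renU-fa : ∀ {ρ i} r → i ∈fa renU ρ r → i ∈fa r
  renU-fa (atom i)     fa-atom     = fa-atom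
  renU-fa (lam A r)    (fa-lam p)  = fa-lam (renU-fa r p)
  renU-fa (app r s)    (fa-appˡ p) = fa-appˡ (renU-fa r p)
  renU-fa (app r s)    (fa-appʳ p) = fa-appʳ (renU-fa s p)
  renU-fa (box r)      (fa-box p)  = fa-box (renU-fa r p)
  renU-fa (letbox s r) (fa-letˡ p) = fa-letˡ (renU-fa s p)
  renU-fa (letbox s r) (fa-letʳ p) = fa-letʳ (renU-fa r p)

  renU-typing : ∀ {Γa Γx Δ ρ r A} → (∀ {i B} → Γx ∋ i ∶ B → Δ ∋ ρ i ∶ B) →
                Γa ∣ Γx ⊢ r ∶ A → Γa ∣ Δ ⊢ renU ρ r ∶ A
  renU-typing h (hyp x)    = hyp x
  renU-typing h const      = const
  renU-typing h (lamI d)   = lamI (renU-typing h d)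
  renU-typing h (appE d e) = appE (renU-typing h d) (renU-typing h e)
  renU-typing {r = box r} h (boxI d nf) = boxI (renU-typing h d) (λ i p → nf i (renU-fa r p))
  renU-typing {Γx = Γx} {Δ = Δ} {ρ = ρ} h (boxE d e) = boxE (renU-typing h d) (renU-typing h' e)
    where
      h' : ∀ {B' i B} → (B' ∷ Γx) ∋ i ∶ B → (B' ∷ Δ) ∋ liftR ρ i ∶ B
      h' here      = here
      h' (there x) = there (h x)
  renU-typing h (ext x)    = ext (h x)

  agree : ∀ {Γa Γa' Γx r A} → (∀ {i B} → i ∈fa r → Γa ∋ i ∶ B → Γa' ∋ i ∶ B) →
          Γa ∣ Γx ⊢ r ∶ A → Γa' ∣ Γx ⊢ r ∶ A
  agree h (hyp x)     = hyp (h fa-atom x)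
  agree h const       = const
  agree {Γa} {Γa'} h (lamI {A = A} d) = lamI (agree h' d)
    where
      h' : ∀ {i B} → _ → (A ∷ Γa) ∋ i ∶ B → (A ∷ Γa') ∋ i ∶ B
      h' p here      = here
      h' p (there x) = there (h (fa-lam p) x)
  agree h (appE d e)  = appE (agree (λ p → h (fa-appˡ p)) d) (agree (λ p → h (fa-appʳ p)) e)
  agree h (boxI d nf) = boxI (agree (λ p → h (fa-box p)) d) nf
  agree h (boxE d e)  = boxE (agree (λ p → h (fa-letˡ p)) d) (agree (λ p → h (fa-letʳ p)) e)
  agree h (ext x)     = ext x

  sub-fa : ∀ {σ i} → (∀ j → NoFreeAtoms (σ j)) → ∀ r → i ∈fa sub σ r → i ∈fa r
  sub-fa {σ} h (unk j)      p           = ⊥-elim (h j _ p)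
  sub-fa h (atom i)     fa-atom     = fa-atom
  sub-fa h (lam A r)    (fa-lam p)  = fa-lam (sub-fa h r p)
  sub-fa h (app r s)    (fa-appˡ p) = fa-appˡ (sub-fa h r p)
  sub-fa h (app r s)    (fa-appʳ p) = fa-appʳ (sub-fa h s p)
  sub-fa h (box r)      (fa-box p)  = fa-box (sub-fa h r p)
  sub-fa h (letbox s r) (fa-letˡ p) = fa-letˡ (sub-fa h s p)
  sub-fa {σ} h (letbox s r) (fa-letʳ p) = fa-letʳ (sub-fa h' r p)
    where
      h' : ∀ j → NoFreeAtoms (liftS σ j)
      h' zero    i ()
      h' (suc j) i q = h j i (renU-fa (σ j) q)

  sub-typing : ∀ {Γa Γx Δ σ r A} → (∀ j → NoFreeAtoms (σ j)) →
               (∀ {i B} → Γx ∋ i ∶ B → [] ∣ Δ ⊢ σ i ∶ B) →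
               Γa ∣ Γx ⊢ r ∶ A → Γa ∣ Δ ⊢ sub σ r ∶ A
  sub-typing nf h (hyp x)    = hyp x
  sub-typing nf h const      = const
  sub-typing nf h (lamI d)   = lamI (sub-typing nf h d)
  sub-typing nf h (appE d e) = appE (sub-typing nf h d) (sub-typing nf h e)
  sub-typing {r = box r} nf h (boxI d nfr) =
    boxI (sub-typing nf h d) (λ i p → nfr i (sub-fa nf r p))
  sub-typing {Γx = Γx} {Δ = Δ} {σ = σ} nf h (boxE d e) =
    boxE (sub-typing nf h d) (sub-typing nf' h' e)
    where
      nf' : ∀ j → NoFreeAtoms (liftS σ j)
      nf' zero    i ()
      nf' (suc j) i q = nf j i (renU-fa (σ j) q)
      h' : ∀ {B' i B} → (B' ∷ Γx) ∋ i ∶ B → [] ∣ B' ∷ Δ ⊢ liftS σ i ∶ B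
      h' here      = ext here
      h' {i = suc i} (there x) = renU-typing there (h x)
  sub-typing {σ = σ} nf h (ext {i = i} x) = agree (λ p _ → ⊥-elim (nf i _ p)) (h x)

  -- {□ r | ∅ ⊢ □ r : □ A}, represented by r together with an (irrelevant)
  -- typing derivation of □ r in the empty context
  record Code (A : Ty) : Set where
    constructor code
    field
      term  : Tm
      typed : Irrelevant ([] ∣ [] ⊢ box term ∶ □ A)

  ⟦_⟧T : Ty → Set
  ⟦ o ⟧T     = Bool
  ⟦ nat ⟧T   = ℕ
  ⟦ A ⇒ B ⟧T = ⟦ A ⟧T → ⟦ B ⟧T
  ⟦ □ A ⟧T   = Code A × ⟦ A ⟧T

  hd : ∀ {A} → ⟦ □ A ⟧T → Code A
  hd = proj₁

  tl : ∀ {A} → ⟦ □ A ⟧T → ⟦ A ⟧T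
  tl = proj₂

  record Env (Γ : Ctx) : Set where
    constructor _∣_
    field
      atomsV : All ⟦_⟧T (Ctx.atoms Γ)
      unksV  : All (λ A → ⟦ □ A ⟧T) (Ctx.unks Γ)

  lookupV : ∀ {P : Ty → Set} {Γ i A} → All P Γ → Γ ∋ i ∶ A → P A
  lookupV (px ∷ _) here      = px
  lookupV (_ ∷ xs) (there x) = lookupV xs x

  extendX : ∀ {Γa Γx B} → Env (Γa ∣ Γx) → ⟦ □ B ⟧T → Env (Γa ∣ B ∷ Γx)
  extendX (va ∣ vx) v = va ∣ (v ∷ vx)

  extendA : ∀ {Γa Γx A} → Env (Γa ∣ Γx) → ⟦ A ⟧T → Env (A ∷ Γa ∣ Γx)
  extendA (va ∣ vx) v = (v ∷ va) ∣ vx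

  -- ς_X : the unknowns-substitution X ↦ hd(ς(X))
  -- (unknowns outside dom ς are left alone, reindexed past the context)
  σX' : ∀ {Γx} → All (λ A → ⟦ □ A ⟧T) Γx → ℕ → Tm
  σX' []       i       = unk i
  σX' (v ∷ vs) zero    = Code.term (hd v)
  σX' (v ∷ vs) (suc i) = σX' vs i

  σX : ∀ {Γ} → Env Γ → ℕ → Tm
  σX (_ ∣ vx) = σX' vx

  private
    codeOK : ∀ {A} (c : Code A) →
             Irrelevant (NoFreeAtoms (Code.term c) × ([] ∣ [] ⊢ Code.term c ∶ A))
    codeOK (code t p) = Irr.map (λ { (boxI d nf) → nf , d }) p

    envOK : ∀ {Γx} (vs : All (λ A → ⟦ □ A ⟧T) Γx) →
            Irrelevant ((∀ j → NoFreeAtoms (σX' vs j)) ×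
                        (∀ {i B} → Γx ∋ i ∶ B → [] ∣ [] ⊢ σX' vs i ∶ B))
    envOK [] = [ ((λ j i ()) , λ ()) ]
    envOK (v ∷ vs) = zipWith comb (codeOK (hd v)) (envOK vs)
      where
        comb : _ → _ → _
        comb (nf0 , d0) (nfs , ds) =
          (λ { zero → nf0 ; (suc j) → nfs j }) ,
          (λ { here → d0 ; (there x) → ds x })

  boxCode : ∀ {Γ r A} (ς : Env Γ) → Γ ⊢ r ∶ A → NoFreeAtoms r → Code A
  boxCode {Γa ∣ Γx} {r} (va ∣ vx) d nf =
    code (sub (σX' vx) r) (Irr.map mk (envOK vx))
    where
      mk : _ → _
      mk (nfs , ds) =
        let d' = sub-typing nfs ds d
            nf' : NoFreeAtoms (sub (σX' vx) r)
            nf' i p = nf i (sub-fa nfs r p)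
        in boxI (agree (λ p _ → ⊥-elim (nf' _ p)) d') nf'

  module Sem (ι : (k : K) → ⟦ κ k ⟧T) where

    ⟦_⟧C : (c : Con) → ⟦ ctype c ⟧T
    ⟦ top ⟧C     = true
    ⟦ bot ⟧C     = false
    ⟦ isapp A ⟧C = λ v → isApp (Code.term (hd v))
    ⟦ other k ⟧C = ι k

    ⟦_⟧ : ∀ {Γ r A} → Γ ⊢ r ∶ A → Env Γ → ⟦ A ⟧T
    ⟦ hyp x ⟧      ς = lookupV (Env.atomsV ς) x
    ⟦ const {c = c} ⟧ ς = ⟦ c ⟧C
    ⟦ lamI d ⟧     ς = λ x → ⟦ d ⟧ (extendA ς x)
    ⟦ appE d e ⟧   ς = ⟦ d ⟧ ς (⟦ e ⟧ ς)
    ⟦ boxI d nf ⟧  ς = boxCode ς d nf , ⟦ d ⟧ ς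
    ⟦ boxE d e ⟧   ς = ⟦ e ⟧ (extendX ς (⟦ d ⟧ ς))
    ⟦ ext x ⟧      ς = tl (lookupV (Env.unksV ς) x)

module Submission where

open import Defs
open import Data.Product using (_×_)
open import Relation.Binary.PropositionalEquality using (_≡_)
open import Level using (0ℓ)
open import Data.List using (_∷_)
open import Axiom.Extensionality.Propositional using (Extensionality)

open import Data.Nat using (ℕ; zero; suc)
open import Data.List using (List)
open import Data.List.Relation.Unary.All using (All; _∷_)
open import Data.Product using (_,_; proj₁; proj₂)
open import Data.Empty using (⊥-elim)
open import Function using (_∘_)
open import Relation.Binary.PropositionalEquality
  using (refl; sym; trans; cong; cong₂; module ≡-Reasoning)

-- The proof generalises the singleton [X := □ s] to an arbitrary closed
-- unknowns-substitution σ, and the valuation ς[X := ...] to any unknowns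
-- valuation that "realises" σ: each of its entries is the denotation of the
-- boxed term σ(X), both in its syntactic head and in its semantic tail.
-- The theorem is the instance σ = [X := □ s], plus one use of coherence.

∋-irrelevant : ∀ {Γ i B} (x y : Γ ∋ i ∶ B) → x ≡ y
∋-irrelevant here      here      = refl
∋-irrelevant (there x) (there y) = cong there (∋-irrelevant x y)

∋-functional : ∀ {Γ i A B} → Γ ∋ i ∶ A → Γ ∋ i ∶ B → A ≡ B
∋-functional here      here      = refl
∋-functional (there x) (there y) = ∋-functional x y

module Development (fe : Extensionality 0ℓ 0ℓ) (K : Set) (κ : K → Ty) where
  open Lang K κ

  liftR-∘ : ∀ ρ ρ' → liftR ρ ∘ liftR ρ' ≡ liftR (ρ ∘ ρ')
  liftR-∘ ρ ρ' = fe λ { zero → refl ; (suc i) → refl }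

  renU-∘ : ∀ ρ ρ' t → renU ρ (renU ρ' t) ≡ renU (ρ ∘ ρ') t
  renU-∘ ρ ρ' (con c)      = refl
  renU-∘ ρ ρ' (atom i)     = refl
  renU-∘ ρ ρ' (unk i)      = refl
  renU-∘ ρ ρ' (lam A t)    = cong (lam A) (renU-∘ ρ ρ' t)
  renU-∘ ρ ρ' (app t u)    = cong₂ app (renU-∘ ρ ρ' t) (renU-∘ ρ ρ' u)
  renU-∘ ρ ρ' (box t)      = cong box (renU-∘ ρ ρ' t)
  renU-∘ ρ ρ' (letbox t u) = cong₂ letbox (renU-∘ ρ ρ' t)
    (trans (renU-∘ (liftR ρ) (liftR ρ') u) (cong (λ f → renU f u) (liftR-∘ ρ ρ')))

  liftS-liftR : ∀ σ ρ → liftS σ ∘ liftR ρ ≡ liftS (σ ∘ ρ)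
  liftS-liftR σ ρ = fe λ { zero → refl ; (suc i) → refl }

  sub-renU : ∀ σ ρ t → sub σ (renU ρ t) ≡ sub (σ ∘ ρ) t
  sub-renU σ ρ (con c)      = refl
  sub-renU σ ρ (atom i)     = refl
  sub-renU σ ρ (unk i)      = refl
  sub-renU σ ρ (lam A t)    = cong (lam A) (sub-renU σ ρ t)
  sub-renU σ ρ (app t u)    = cong₂ app (sub-renU σ ρ t) (sub-renU σ ρ u)
  sub-renU σ ρ (box t)      = cong box (sub-renU σ ρ t)
  sub-renU σ ρ (letbox t u) = cong₂ letbox (sub-renU σ ρ t)
    (trans (sub-renU (liftS σ) (liftR ρ) u) (cong (λ f → sub f u) (liftS-liftR σ ρ)))

  liftR-liftS : ∀ ρ σ → renU (liftR ρ) ∘ liftS σ ≡ liftS (renU ρ ∘ σ)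
  liftR-liftS ρ σ = fe λ
    { zero    → refl
    ; (suc i) → trans (renU-∘ (liftR ρ) suc (σ i)) (sym (renU-∘ suc ρ (σ i))) }

  renU-sub : ∀ ρ σ t → renU ρ (sub σ t) ≡ sub (renU ρ ∘ σ) t
  renU-sub ρ σ (con c)      = refl
  renU-sub ρ σ (atom i)     = refl
  renU-sub ρ σ (unk i)      = refl
  renU-sub ρ σ (lam A t)    = cong (lam A) (renU-sub ρ σ t)
  renU-sub ρ σ (app t u)    = cong₂ app (renU-sub ρ σ t) (renU-sub ρ σ u)
  renU-sub ρ σ (box t)      = cong box (renU-sub ρ σ t)
  renU-sub ρ σ (letbox t u) = cong₂ letbox (renU-sub ρ σ t)
    (trans (renU-sub (liftR ρ) (liftS σ) u) (cong (λ f → sub f u) (liftR-liftS ρ σ)))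

  liftS-liftS : ∀ τ σ → sub (liftS τ) ∘ liftS σ ≡ liftS (sub τ ∘ σ)
  liftS-liftS τ σ = fe λ
    { zero    → refl
    ; (suc i) → trans (sub-renU (liftS τ) suc (σ i)) (sym (renU-sub suc τ (σ i))) }

  sub-sub : ∀ τ σ t → sub τ (sub σ t) ≡ sub (sub τ ∘ σ) t
  sub-sub τ σ (con c)      = refl
  sub-sub τ σ (atom i)     = refl
  sub-sub τ σ (unk i)      = refl
  sub-sub τ σ (lam A t)    = cong (lam A) (sub-sub τ σ t)
  sub-sub τ σ (app t u)    = cong₂ app (sub-sub τ σ t) (sub-sub τ σ u)
  sub-sub τ σ (box t)      = cong box (sub-sub τ σ t)
  sub-sub τ σ (letbox t u) = cong₂ letbox (sub-sub τ σ t)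
    (trans (sub-sub (liftS τ) (liftS σ) u) (cong (λ f → sub f u) (liftS-liftS τ σ)))

  sub-agreeOn : ∀ {Γa Γx r A σ τ} → Γa ∣ Γx ⊢ r ∶ A →
                (∀ {i B} → Γx ∋ i ∶ B → σ i ≡ τ i) → sub σ r ≡ sub τ r
  sub-agreeOn (hyp x)     h = refl
  sub-agreeOn const       h = refl
  sub-agreeOn (lamI d)    h = cong (lam _) (sub-agreeOn d h)
  sub-agreeOn (appE d e)  h = cong₂ app (sub-agreeOn d h) (sub-agreeOn e h)
  sub-agreeOn (boxI d _)  h = cong box (sub-agreeOn d h)
  sub-agreeOn {Γx = Γx} {σ = σ} {τ = τ} (boxE {A = C} d e) h =
    cong₂ letbox (sub-agreeOn d h) (sub-agreeOn e lifted)
    where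
      lifted : ∀ {i B} → (C ∷ Γx) ∋ i ∶ B → liftS σ i ≡ liftS τ i
      lifted here      = refl
      lifted (there x) = cong (renU suc) (h x)
  sub-agreeOn (ext x)     h = h x

  -- Closed substitutions (no free atoms in any σ i) whose values are typed
  -- in every atom context; this is the invariant that survives going under
  -- both binders, λ (new atom) and letbox (new unknown).
  ClosedSubst : (ℕ → Tm) → Set
  ClosedSubst σ = ∀ j → NoFreeAtoms (σ j)

  SubstTyping : (ℕ → Tm) → List Ty → List Ty → Set
  SubstTyping σ Γx Δ = ∀ {i B} → Γx ∋ i ∶ B → ∀ {Γa} → Γa ∣ Δ ⊢ σ i ∶ B

  liftClosed : ∀ {σ} → ClosedSubst σ → ClosedSubst (liftS σ)
  liftClosed nf zero    i ()
  liftClosed {σ} nf (suc j) i q = nf j i (renU-fa (σ j) q)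

  liftTyping : ∀ {σ Γx Δ B} → SubstTyping σ Γx Δ → SubstTyping (liftS σ) (B ∷ Γx) (B ∷ Δ)
  liftTyping dt here      = ext here
  liftTyping dt (there x) = renU-typing there (dt x)

  sub-typed : ∀ {σ Γa Γx Δ r A} → ClosedSubst σ → SubstTyping σ Γx Δ →
              Γa ∣ Γx ⊢ r ∶ A → Γa ∣ Δ ⊢ sub σ r ∶ A
  sub-typed nf dt (hyp x)    = hyp x
  sub-typed nf dt const      = const
  sub-typed nf dt (lamI d)   = lamI (sub-typed nf dt d)
  sub-typed nf dt (appE d e) = appE (sub-typed nf dt d) (sub-typed nf dt e)
  sub-typed nf dt (boxI {r = r} d nfr) =
    boxI (sub-typed nf dt d) (λ i p → nfr i (sub-fa nf r p))
  sub-typed nf dt (boxE ds dr) =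
    boxE (sub-typed nf dt ds) (sub-typed (liftClosed nf) (liftTyping dt) dr)
  sub-typed nf dt (ext x)    = dt x

  single-closed : ∀ {s} → NoFreeAtoms s → ClosedSubst (single s)
  single-closed nfs zero    = nfs
  single-closed nfs (suc j) i ()

  single-typing : ∀ {Γa Γx B s} → Γa ∣ Γx ⊢ s ∶ B → NoFreeAtoms s →
                  SubstTyping (single s) (B ∷ Γx) Γx
  single-typing ds nfs here      = agree (λ p _ → ⊥-elim (nfs _ p)) ds
  single-typing ds nfs (there x) = ext x

  AtomsAgree : Tm → List Ty → List Ty → Set
  AtomsAgree r Γ₁ Γ₂ = ∀ {i B} → i ∈fa r → Γ₁ ∋ i ∶ B → Γ₂ ∋ i ∶ B

  atomsAgree-lam : ∀ {A r Γ₁ Γ₂} → AtomsAgree (lam A r) Γ₁ Γ₂ → AtomsAgree r (A ∷ Γ₁) (A ∷ Γ₂)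
  atomsAgree-lam t p here      = here
  atomsAgree-lam t p (there x) = there (t (fa-lam p) x)

  type-unique : ∀ {Γ₁ Γ₂ Γx r A₁ A₂} → Γ₁ ∣ Γx ⊢ r ∶ A₁ → Γ₂ ∣ Γx ⊢ r ∶ A₂ →
                AtomsAgree r Γ₁ Γ₂ → A₁ ≡ A₂
  type-unique (hyp x₁)     (hyp x₂)     t = ∋-functional (t fa-atom x₁) x₂
  type-unique const        const        t = refl
  type-unique (lamI d₁)    (lamI d₂)    t = cong (_ ⇒_) (type-unique d₁ d₂ (atomsAgree-lam t))
  type-unique (appE f₁ a₁) (appE f₂ a₂) t with type-unique f₁ f₂ (λ p → t (fa-appˡ p))
  ... | refl = refl
  type-unique (boxI d₁ _)  (boxI d₂ _)  t = cong □ (type-unique d₁ d₂ (λ p → t (fa-box p)))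
  type-unique (boxE s₁ r₁) (boxE s₂ r₂) t with type-unique s₁ s₂ (λ p → t (fa-letˡ p))
  ... | refl = type-unique r₁ r₂ (λ p → t (fa-letʳ p))
  type-unique (ext x₁)     (ext x₂)     t = ∋-functional x₁ x₂

  code-≡ : ∀ {A} {c₁ c₂ : Code A} → Code.term c₁ ≡ Code.term c₂ → c₁ ≡ c₂
  code-≡ {c₁ = code t p} {c₂ = code .t q} refl = refl

  UnkValuation : List Ty → Set
  UnkValuation Γx = All (λ A → ⟦ □ A ⟧T) Γx

  σX'-lookup : ∀ {Γx i B} (vx : UnkValuation Γx) (x : Γx ∋ i ∶ B) →
               σX' vx i ≡ Code.term (hd (lookupV vx x))
  σX'-lookup (v ∷ vx) here      = refl
  σX'-lookup (v ∷ vx) (there x) = σX'-lookup vx x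

  module Denotation (ι : (k : K) → ⟦ κ k ⟧T) where
    open Sem ι

    ValuesAgree : ∀ {Γ₁ Γ₂} → Tm → All ⟦_⟧T Γ₁ → All ⟦_⟧T Γ₂ → Set
    ValuesAgree {Γ₁} {Γ₂} r va₁ va₂ = ∀ {i B} → i ∈fa r →
      (x₁ : Γ₁ ∋ i ∶ B) (x₂ : Γ₂ ∋ i ∶ B) → lookupV va₁ x₁ ≡ lookupV va₂ x₂

    valuesAgree-lam : ∀ {A r Γ₁ Γ₂} {va₁ : All ⟦_⟧T Γ₁} {va₂ : All ⟦_⟧T Γ₂} (x : ⟦ A ⟧T) →
                      ValuesAgree (lam A r) va₁ va₂ → ValuesAgree r (x ∷ va₁) (x ∷ va₂)
    valuesAgree-lam x v p here       here       = refl
    valuesAgree-lam x v p (there x₁) (there x₂) = v (fa-lam p) x₁ x₂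

    coherence-on-atoms :
      ∀ {Γ₁ Γ₂ Γx r A} (d₁ : Γ₁ ∣ Γx ⊢ r ∶ A) (d₂ : Γ₂ ∣ Γx ⊢ r ∶ A)
      (va₁ : All ⟦_⟧T Γ₁) (va₂ : All ⟦_⟧T Γ₂) (vx : UnkValuation Γx) →
      AtomsAgree r Γ₁ Γ₂ → ValuesAgree r va₁ va₂ → ⟦ d₁ ⟧ (va₁ ∣ vx) ≡ ⟦ d₂ ⟧ (va₂ ∣ vx)
    coherence-on-atoms (hyp x₁) (hyp x₂) va₁ va₂ vx t v = v fa-atom x₁ x₂
    coherence-on-atoms const const va₁ va₂ vx t v = refl
    coherence-on-atoms (lamI d₁) (lamI d₂) va₁ va₂ vx t v = fe λ x →
      coherence-on-atoms d₁ d₂ (x ∷ va₁) (x ∷ va₂) vx (atomsAgree-lam t) (valuesAgree-lam x v)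
    coherence-on-atoms (appE f₁ a₁) (appE f₂ a₂) va₁ va₂ vx t v
      with type-unique f₁ f₂ (λ p → t (fa-appˡ p))
    ... | refl = cong₂ (λ f a → f a)
      (coherence-on-atoms f₁ f₂ va₁ va₂ vx (λ p → t (fa-appˡ p)) (λ p → v (fa-appˡ p)))
      (coherence-on-atoms a₁ a₂ va₁ va₂ vx (λ p → t (fa-appʳ p)) (λ p → v (fa-appʳ p)))
    coherence-on-atoms (boxI d₁ _) (boxI d₂ _) va₁ va₂ vx t v = cong₂ _,_ (code-≡ refl)
      (coherence-on-atoms d₁ d₂ va₁ va₂ vx (λ p → t (fa-box p)) (λ p → v (fa-box p)))
    coherence-on-atoms (boxE s₁ r₁) (boxE s₂ r₂) va₁ va₂ vx t v
      with type-unique s₁ s₂ (λ p → t (fa-letˡ p))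
    ... | refl = trans
      (cong (λ w → ⟦ r₁ ⟧ (va₁ ∣ w ∷ vx))
            (coherence-on-atoms s₁ s₂ va₁ va₂ vx (λ p → t (fa-letˡ p)) (λ p → v (fa-letˡ p))))
      (coherence-on-atoms r₁ r₂ va₁ va₂ _ (λ p → t (fa-letʳ p)) (λ p → v (fa-letʳ p)))
    coherence-on-atoms (ext x₁) (ext x₂) va₁ va₂ vx t v =
      cong (λ z → tl (lookupV vx z)) (∋-irrelevant x₁ x₂)

    coherence : ∀ {Γa Γx r A} (d₁ d₂ : Γa ∣ Γx ⊢ r ∶ A) (ς : Env (Γa ∣ Γx)) →
                ⟦ d₁ ⟧ ς ≡ ⟦ d₂ ⟧ ς
    coherence d₁ d₂ (va ∣ vx) = coherence-on-atoms d₁ d₂ va va vx (λ _ x → x)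
      (λ _ x₁ x₂ → cong (lookupV va) (∋-irrelevant x₁ x₂))

    closed-denotation : ∀ {Γ₁ Γ₂ Γx r A} → NoFreeAtoms r →
      (d₁ : Γ₁ ∣ Γx ⊢ r ∶ A) (d₂ : Γ₂ ∣ Γx ⊢ r ∶ A)
      (va₁ : All ⟦_⟧T Γ₁) (va₂ : All ⟦_⟧T Γ₂) (vx : UnkValuation Γx) →
      ⟦ d₁ ⟧ (va₁ ∣ vx) ≡ ⟦ d₂ ⟧ (va₂ ∣ vx)
    closed-denotation nf d₁ d₂ va₁ va₂ vx = coherence-on-atoms d₁ d₂ va₁ va₂ vx
      (λ p _ → ⊥-elim (nf _ p)) (λ p _ _ → ⊥-elim (nf _ p))

    ⟦⟧-renU : ∀ {Γa Γx Δ ρ r A} (h : ∀ {i B} → Γx ∋ i ∶ B → Δ ∋ ρ i ∶ B)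
              {vx : UnkValuation Γx} {vx' : UnkValuation Δ} →
              (∀ {i B} (x : Γx ∋ i ∶ B) (y : Δ ∋ ρ i ∶ B) → lookupV vx' y ≡ lookupV vx x) →
              (d : Γa ∣ Γx ⊢ r ∶ A) (va : All ⟦_⟧T Γa) →
              ⟦ renU-typing h d ⟧ (va ∣ vx') ≡ ⟦ d ⟧ (va ∣ vx)
    ⟦⟧-renU h same (hyp x)    va = refl
    ⟦⟧-renU h same const      va = refl
    ⟦⟧-renU h same (lamI d)   va = fe λ x → ⟦⟧-renU h same d (x ∷ va)
    ⟦⟧-renU h same (appE d e) va = cong₂ (λ f a → f a) (⟦⟧-renU h same d va) (⟦⟧-renU h same e va)
    ⟦⟧-renU {ρ = ρ} h {vx} {vx'} same (boxI {r = r} d _) va =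
      cong₂ _,_ (code-≡ (trans (sub-renU (σX' vx') ρ r) (sub-agreeOn d σX-renamed)))
                (⟦⟧-renU h same d va)
      where
        σX-renamed : ∀ {i B} → _ ∋ i ∶ B → σX' vx' (ρ i) ≡ σX' vx i
        σX-renamed {i} x = begin
          σX' vx' (ρ i)                       ≡⟨ σX'-lookup vx' (h x) ⟩
          Code.term (hd (lookupV vx' (h x)))  ≡⟨ cong (Code.term ∘ hd) (same x (h x)) ⟩
          Code.term (hd (lookupV vx x))       ≡⟨ σX'-lookup vx x ⟨
          σX' vx i                            ∎
          where open ≡-Reasoning
    ⟦⟧-renU h same (boxE ds dr) va = ⟦⟧-renU _ same' dr va
      where
        same' : ∀ {i B} (x : _ ∋ i ∶ B) (y : _ ∋ liftR _ i ∶ B) → _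
        same' here      here      = ⟦⟧-renU h same ds va
        same' (there x) (there y) = same x y
    ⟦⟧-renU h same (ext x)    va = cong tl (same x (h x))

    Realises : ∀ {σ Γx Δ} → SubstTyping σ Γx Δ → UnkValuation Γx → UnkValuation Δ → Set
    Realises {σ} {Γx} dt vx vx' = ∀ {i B} (x : Γx ∋ i ∶ B) →
      (Code.term (hd (lookupV vx x)) ≡ sub (σX' vx') (σ i)) ×
      (∀ {Γa} (va : All ⟦_⟧T Γa) → tl (lookupV vx x) ≡ ⟦ dt x ⟧ (va ∣ vx'))

    realises-lift : ∀ {σ Γx Δ B} {dt : SubstTyping σ Γx Δ}
                    {vx : UnkValuation Γx} {vx' : UnkValuation Δ} {v v' : ⟦ □ B ⟧T} →
                    Realises dt vx vx' → v ≡ v' → Realises (liftTyping dt) (v ∷ vx) (v' ∷ vx')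
    realises-lift R v≡v' here = cong (Code.term ∘ hd) v≡v' , λ va → cong tl v≡v'
    realises-lift {σ} {dt = dt} {vx' = vx'} {v' = v'} R v≡v' (there {i = i} x) =
      trans (proj₁ (R x)) (sym (sub-renU (σX' (v' ∷ vx')) suc (σ i))) ,
      λ va → trans (proj₂ (R x) va) (sym (⟦⟧-renU there
        (λ { x (there y) → cong (lookupV vx') (∋-irrelevant y x) }) (dt x) va))

    ⟦⟧-sub : ∀ {σ Γa Γx Δ r A} (nf : ClosedSubst σ) (dt : SubstTyping σ Γx Δ)
             {vx : UnkValuation Γx} {vx' : UnkValuation Δ} → Realises dt vx vx' →
             (d : Γa ∣ Γx ⊢ r ∶ A) (va : All ⟦_⟧T Γa) →
             ⟦ sub-typed nf dt d ⟧ (va ∣ vx') ≡ ⟦ d ⟧ (va ∣ vx)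
    ⟦⟧-sub nf dt R (hyp x)    va = refl
    ⟦⟧-sub nf dt R const      va = refl
    ⟦⟧-sub nf dt R (lamI d)   va = fe λ x → ⟦⟧-sub nf dt R d (x ∷ va)
    ⟦⟧-sub nf dt R (appE d e) va = cong₂ (λ f a → f a) (⟦⟧-sub nf dt R d va) (⟦⟧-sub nf dt R e va)
    ⟦⟧-sub {σ} nf dt {vx} {vx'} R (boxI {r = r} d _) va =
      cong₂ _,_ (code-≡ (trans (sub-sub (σX' vx') σ r) (sub-agreeOn d σX-realised)))
                (⟦⟧-sub nf dt R d va)
      where
        σX-realised : ∀ {i B} → _ ∋ i ∶ B → sub (σX' vx') (σ i) ≡ σX' vx i
        σX-realised x = sym (trans (σX'-lookup vx x) (proj₁ (R x)))
    ⟦⟧-sub nf dt R (boxE ds dr) va = ⟦⟧-sub (liftClosed nf) (liftTyping dt)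
      (realises-lift R (sym (⟦⟧-sub nf dt R ds va))) dr va
    ⟦⟧-sub nf dt R (ext x)    va = sym (proj₂ (R x) va)

    single-realises : ∀ {Γa Γx B s} (ds : Γa ∣ Γx ⊢ s ∶ B) (nfs : NoFreeAtoms s)
                      (va : All ⟦_⟧T Γa) (vx : UnkValuation Γx) →
                      Realises (single-typing ds nfs) (⟦ boxI ds nfs ⟧ (va ∣ vx) ∷ vx) vx
    single-realises ds nfs va vx here =
      refl , λ va' → closed-denotation nfs ds (single-typing ds nfs here) va va' vx
    single-realises ds nfs va vx (there x) = sym (σX'-lookup vx x) , λ va' → refl

lemma4p7 : Extensionality 0ℓ 0ℓ →
    (K : Set) (κ : K → Ty) →
    let open Lang K κ in
    (ι : (k : K) → ⟦ κ k ⟧T) →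
    let open Sem ι in
    ∀ {Γa Γx A B r s} →
    (d : Γa ∣ B ∷ Γx ⊢ r ∶ A) →
    (e : Γa ∣ Γx ⊢ box s ∶ □ B) →
    (ς : Env (Γa ∣ Γx)) →
    (Γa ∣ Γx ⊢ r [X:=□ s ] ∶ A) ×
    ((d' : Γa ∣ Γx ⊢ r [X:=□ s ] ∶ A) →
    ⟦ d' ⟧ ς ≡ ⟦ d ⟧ (extendX ς (⟦ e ⟧ ς)))
lemma4p7 fe K κ ι {Γa} {Γx} {A} {B} {r} {s} d (Lang.boxI ds nfs) (va Lang.∣ vx) =
  substituted , λ d' → begin
    ⟦ d' ⟧ (va ∣ vx)           ≡⟨ coherence d' substituted (va ∣ vx) ⟩
    ⟦ substituted ⟧ (va ∣ vx)  ≡⟨ ⟦⟧-sub closed typed (single-realises ds nfs va vx) d va ⟩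
    ⟦ d ⟧ (extendX (va ∣ vx) (⟦ boxI ds nfs ⟧ (va ∣ vx))) ∎
  where
    open Lang K κ
    open Sem ι
    open Development fe K κ
    open Denotation ι
    open ≡-Reasoning

    closed : ClosedSubst (single s)
    closed = single-closed nfs

    typed : SubstTyping (single s) (B ∷ Γx) Γx
    typed = single-typing ds nfs

    substituted : Γa ∣ Γx ⊢ r [X:=□ s ] ∶ A
    substituted = sub-typed closed typed d
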